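{- Let $K=\mathcal{VR}(\mathcal{F}_1^n\cup\mathcal{F}_2^n;3)$. Every maximal face of $K$ is the intersection of the vertex set $\mathcal{F}_1^n\cup\mathcal{F}_2^n$ with a set of one of the following forms, for some $i_1,i_2,i_3\in[n]$: (i) $N[\emptyset]\cup N[\{i_1\}]$; (ii) $N[\emptyset]\cup H^{i_1,i_2,i_3}_{\emptyset}$.
   Context: $\mathcal{F}_k^n$ is the set of $k$-element subsets of $[n]$; subsets carry the metric $d(B,C)=|B\Delta C|$; $\mathcal{VR}(X;r)$ is the simplicial complex on $X$ whose simplices are nonempty finite subsets of diameter $\le r$. For $C\subseteq[n]$, $N[C]=\{C\}\cup\{D\subseteq[n]:|C\Delta D|=1\}$; $C^{j_1,\dots,j_k}=C\Delta\{j_1,\dots,j_k\}$; $H^{j_1,j_2,j_3}_C=\{C,C^{j_1,j_2},C^{j_1,j_3},C^{j_2,j_3}\}$. -}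

module Defs where

open import Data.Nat using (ℕ; _≤_)
open import Data.Fin using (Fin)
open import Data.Bool using (_xor_)
open import Data.Vec using (zipWith)
open import Data.List using (List)
open import Data.List.Membership.Propositional using (_∈_)
open import Data.Product using (_×_; ∃-syntax)
open import Data.Sum using (_⊎_)
open import Relation.Binary.PropositionalEquality using (_≡_)
open import Data.Fin.Subset as S using (Subset; ∣_∣; ⁅_⁆; _∪_)

_Δ_ : ∀ {n} → Subset n → Subset n → Subset n
B Δ C = zipWith _xor_ B C

dist : ∀ {n} → Subset n → Subset n → ℕ
dist B C = ∣ B Δ C ∣

∅ : ∀ {n} → Subset n
∅ = S.⊥

Vertex : ∀ {n} → Subset n → Set
Vertex x = ∣ x ∣ ≡ 1 ⊎ ∣ x ∣ ≡ 2

-- Faces (simplices) of K = VR(F_1^n ∪ F_2^n ; 3): nonempty finite sets of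
-- vertices of diameter ≤ 3.  A finite set is given by a list (membership only matters).
IsFace : ∀ {n} → List (Subset n) → Set
IsFace {n} σ =
  (∀ {x} → x ∈ σ → Vertex x) ×
  (∃[ x ] (x ∈ σ)) ×
  (∀ {x y} → x ∈ σ → y ∈ σ → dist x y ≤ 3)

_⊆L_ : ∀ {n} → List (Subset n) → List (Subset n) → Set
σ ⊆L τ = ∀ {x} → x ∈ σ → x ∈ τ

IsMaximalFace : ∀ {n} → List (Subset n) → Set
IsMaximalFace {n} σ = IsFace σ × (∀ (τ : List (Subset n)) → IsFace τ → σ ⊆L τ → τ ⊆L σ)

N[_] : ∀ {n} → Subset n → Subset n → Set
N[ C ] D = D ≡ C ⊎ dist C D ≡ 1

_^[_,_] : ∀ {n} → Subset n → Fin n → Fin n → Subset n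
C ^[ j₁ , j₂ ] = C Δ (⁅ j₁ ⁆ ∪ ⁅ j₂ ⁆)

H : ∀ {n} → Fin n → Fin n → Fin n → Subset n → Subset n → Set
H j₁ j₂ j₃ C D = D ≡ C ⊎ D ≡ C ^[ j₁ , j₂ ] ⊎ D ≡ C ^[ j₁ , j₃ ] ⊎ D ≡ C ^[ j₂ , j₃ ]

FormI : ∀ {n} → Fin n → Subset n → Set
FormI i₁ D = N[ ∅ ] D ⊎ N[ ⁅ i₁ ⁆ ] D

FormII : ∀ {n} → Fin n → Fin n → Fin n → Subset n → Set
FormII i₁ i₂ i₃ D = N[ ∅ ] D ⊎ H i₁ i₂ i₃ ∅ D

EqVertexMeet : ∀ {n} → List (Subset n) → (Subset n → Set) → Set
EqVertexMeet σ X = ∀ x → (x ∈ σ → Vertex x × X x) × (Vertex x × X x → x ∈ σ)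

-- Vertices are the singletons and 2-sets of [n], and |p| + |q| = d(p,q) + 2|p ∩ q|.
-- Hence a singleton is within distance 3 of every vertex, while two 2-sets are
-- within distance 3 exactly when they meet: a maximal face is the set of all
-- singletons together with a maximal intersecting family of 2-sets.  Such a
-- family is a star or a triangle: if a member bc lies in neither the star at b
-- nor the star at c, there are members r ∌ b and s ∌ c; meeting bc forces
-- r = cd and s = bd', and r ∩ s ≠ ∅ forces d = d'.
module Submission where

open import Defs
open import Data.Nat using (ℕ)
open import Data.Fin using (Fin)
open import Data.Fin.Subset using (Subset)
open import Data.List using (List)
open import Data.Product using (∃-syntax)
open import Data.Sum using (_⊎_)

open import Data.Nat using (suc; _+_; _*_; _≤_; z≤n; s≤s)
import Data.Nat.Properties as ℕ
open import Data.Nat.Tactic.RingSolver using (solve-∀)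
open import Data.Fin using (zero; suc; _≟_)
open import Data.Fin.Properties using (suc-injective)
open import Data.Bool.Properties using (xor-identityˡ; xor-comm; xor-same)
open import Data.Vec using ([]; _∷_; here; there)
open import Data.Vec.Properties using (zipWith-identityˡ; zipWith-comm)
open import Data.Fin.Subset
  using (inside; outside; _∈_; _∉_; _⊆_; ∣_∣; ⁅_⁆; _∪_; _∩_; _-_; Nonempty; Empty)
open import Data.Fin.Subset.Properties
  using ( _∈?_; nonempty?; Empty-unique; ∣⊥∣≡0; ∣⁅x⁆∣≡1; x∈⁅x⁆; x∈⁅y⁆⇒x≡y
        ; x∈p∪q⁺; x∈p∪q⁻; x∈p∩q⁺; x∈p∩q⁻; ∪-identityˡ; ∪-identityʳ; ⊆-antisym
        ; p⊆q⇒∣p∣≤∣q∣; x∈p∧x≢y⇒x∈p-y; x∈p⇒∣p-x∣<∣p∣ )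
open import Data.List using (_∷_; [])
open import Data.List.Relation.Unary.Any using () renaming (here to hereL; there to thereL)
open import Data.List.Membership.Propositional using () renaming (_∈_ to _∈L_)
open import Data.Product using (_,_; _×_; proj₁; proj₂)
open import Data.Sum using (inj₁; inj₂)
import Data.Sum as Sum
open import Function.Bundles using (_⇔_; mk⇔; Equivalence)
open import Function.Construct.Composition using (_⇔-∘_)
open import Relation.Nullary using (¬_; yes; no; contradiction)
open import Relation.Binary.PropositionalEquality
  using (_≡_; _≢_; refl; sym; trans; cong; cong₂; subst; module ≡-Reasoning)

open Equivalence using (to; from)

private
  variable
    n : ℕ
    p q r : Subset n
    x y z : Fin n

Δ-identityˡ : (p : Subset n) → ∅ Δ p ≡ p
Δ-identityˡ = zipWith-identityˡ xor-identityˡ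

Δ-comm : (p q : Subset n) → p Δ q ≡ q Δ p
Δ-comm = zipWith-comm xor-comm

Δ-self : (p : Subset n) → p Δ p ≡ ∅
Δ-self []      = refl
Δ-self (s ∷ p) = cong₂ _∷_ (xor-same s) (Δ-self p)

dist-comm : (p q : Subset n) → dist p q ≡ dist q p
dist-comm p q = cong ∣_∣ (Δ-comm p q)

dist-self : (p : Subset n) → dist p p ≡ 0
dist-self {n} p = trans (cong ∣_∣ (Δ-self p)) (∣⊥∣≡0 n)

dist-∅ : (p : Subset n) → dist ∅ p ≡ ∣ p ∣
dist-∅ p = cong ∣_∣ (Δ-identityˡ p)

∣p∣+∣q∣≡∣pΔq∣+2∣p∩q∣ : (p q : Subset n) → ∣ p ∣ + ∣ q ∣ ≡ ∣ p Δ q ∣ + 2 * ∣ p ∩ q ∣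
∣p∣+∣q∣≡∣pΔq∣+2∣p∩q∣ []          []          = refl
∣p∣+∣q∣≡∣pΔq∣+2∣p∩q∣ (inside  ∷ p) (inside  ∷ q) = begin
  suc ∣ p ∣ + suc ∣ q ∣              ≡⟨ cong suc (ℕ.+-suc ∣ p ∣ ∣ q ∣) ⟩
  2 + (∣ p ∣ + ∣ q ∣)                ≡⟨ cong (2 +_) (∣p∣+∣q∣≡∣pΔq∣+2∣p∩q∣ p q) ⟩
  2 + (∣ p Δ q ∣ + 2 * ∣ p ∩ q ∣)    ≡⟨ shift ∣ p Δ q ∣ ∣ p ∩ q ∣ ⟩
  ∣ p Δ q ∣ + 2 * suc ∣ p ∩ q ∣      ∎
  where
  open ≡-Reasoning
  shift : ∀ m k → 2 + (m + 2 * k) ≡ m + 2 * suc k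
  shift = solve-∀
∣p∣+∣q∣≡∣pΔq∣+2∣p∩q∣ (inside  ∷ p) (outside ∷ q) = cong suc (∣p∣+∣q∣≡∣pΔq∣+2∣p∩q∣ p q)
∣p∣+∣q∣≡∣pΔq∣+2∣p∩q∣ (outside ∷ p) (inside  ∷ q) =
  trans (ℕ.+-suc ∣ p ∣ ∣ q ∣) (cong suc (∣p∣+∣q∣≡∣pΔq∣+2∣p∩q∣ p q))
∣p∣+∣q∣≡∣pΔq∣+2∣p∩q∣ (outside ∷ p) (outside ∷ q) = ∣p∣+∣q∣≡∣pΔq∣+2∣p∩q∣ p q

Nonempty⇒1≤∣p∣ : Nonempty p → 1 ≤ ∣ p ∣
Nonempty⇒1≤∣p∣ {p = p} (x , x∈p) =
  subst (_≤ ∣ p ∣) (∣⁅x⁆∣≡1 x) (p⊆q⇒∣p∣≤∣q∣ λ y∈⁅x⁆ → subst (_∈ p) (sym (x∈⁅y⁆⇒x≡y x y∈⁅x⁆)) x∈p)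

1≤∣p∣⇒Nonempty : 1 ≤ ∣ p ∣ → Nonempty p
1≤∣p∣⇒Nonempty {p = inside  ∷ p} _   = zero , here
1≤∣p∣⇒Nonempty {p = outside ∷ p} 1≤∣p∣ with 1≤∣p∣⇒Nonempty 1≤∣p∣
... | x , x∈p = suc x , there x∈p

dist≤∣p∣+∣q∣ : (p q : Subset n) → dist p q ≤ ∣ p ∣ + ∣ q ∣
dist≤∣p∣+∣q∣ p q =
  subst (dist p q ≤_) (sym (∣p∣+∣q∣≡∣pΔq∣+2∣p∩q∣ p q)) (ℕ.m≤m+n (dist p q) _)

Nonempty-∩⇒dist+2≤ : (p q : Subset n) → Nonempty (p ∩ q) → dist p q + 2 ≤ ∣ p ∣ + ∣ q ∣
Nonempty-∩⇒dist+2≤ p q meet =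
  subst (dist p q + 2 ≤_) (sym (∣p∣+∣q∣≡∣pΔq∣+2∣p∩q∣ p q))
    (ℕ.+-monoʳ-≤ (dist p q) (ℕ.*-monoʳ-≤ 2 (Nonempty⇒1≤∣p∣ meet)))

Empty-∩⇒dist≡ : (p q : Subset n) → Empty (p ∩ q) → dist p q ≡ ∣ p ∣ + ∣ q ∣
Empty-∩⇒dist≡ {n} p q disjoint = begin
  dist p q                        ≡⟨ sym (ℕ.+-identityʳ (dist p q)) ⟩
  dist p q + 2 * 0                ≡⟨ cong (λ k → dist p q + 2 * k) ∣p∩q∣≡0 ⟨
  dist p q + 2 * ∣ p ∩ q ∣        ≡⟨ ∣p∣+∣q∣≡∣pΔq∣+2∣p∩q∣ p q ⟨
  ∣ p ∣ + ∣ q ∣                   ∎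
  where
  open ≡-Reasoning
  ∣p∩q∣≡0 : ∣ p ∩ q ∣ ≡ 0
  ∣p∩q∣≡0 = trans (cong ∣_∣ (Empty-unique disjoint)) (∣⊥∣≡0 n)

singleton-dist≤3 : ∣ p ∣ ≡ 1 → Vertex q → dist p q ≤ 3
singleton-dist≤3 {p = p} {q} ∣p∣≡1 q-vertex = ℕ.≤-trans (dist≤∣p∣+∣q∣ p q) (bound q-vertex)
  where
  bound : Vertex q → ∣ p ∣ + ∣ q ∣ ≤ 3
  bound (inj₁ ∣q∣≡1) = subst (_≤ 3) (sym (cong₂ _+_ ∣p∣≡1 ∣q∣≡1)) (ℕ.n≤1+n 2)
  bound (inj₂ ∣q∣≡2) = ℕ.≤-reflexive (cong₂ _+_ ∣p∣≡1 ∣q∣≡2)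

x∈p⇒1+dist⁅x⁆p≡∣p∣ : x ∈ p → 1 + dist ⁅ x ⁆ p ≡ ∣ p ∣
x∈p⇒1+dist⁅x⁆p≡∣p∣ {p = inside  ∷ p} here        = cong suc (dist-∅ p)
x∈p⇒1+dist⁅x⁆p≡∣p∣ {p = inside  ∷ p} (there x∈p) = cong suc (x∈p⇒1+dist⁅x⁆p≡∣p∣ x∈p)
x∈p⇒1+dist⁅x⁆p≡∣p∣ {p = outside ∷ p} (there x∈p) = x∈p⇒1+dist⁅x⁆p≡∣p∣ x∈p

x∉p⇒dist⁅x⁆p≡1+∣p∣ : x ∉ p → dist ⁅ x ⁆ p ≡ 1 + ∣ p ∣
x∉p⇒dist⁅x⁆p≡1+∣p∣ {x = zero}  {inside  ∷ p} x∉p = contradiction here x∉p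
x∉p⇒dist⁅x⁆p≡1+∣p∣ {x = zero}  {outside ∷ p} _   = cong suc (dist-∅ p)
x∉p⇒dist⁅x⁆p≡1+∣p∣ {x = suc x} {inside  ∷ p} x∉p =
  cong suc (x∉p⇒dist⁅x⁆p≡1+∣p∣ (λ x∈p → x∉p (there x∈p)))
x∉p⇒dist⁅x⁆p≡1+∣p∣ {x = suc x} {outside ∷ p} x∉p =
  x∉p⇒dist⁅x⁆p≡1+∣p∣ (λ x∈p → x∉p (there x∈p))

2-sets-dist≤3⇔meet : ∣ p ∣ ≡ 2 → ∣ q ∣ ≡ 2 → dist p q ≤ 3 ⇔ Nonempty (p ∩ q)
2-sets-dist≤3⇔meet {p = p} {q} ∣p∣≡2 ∣q∣≡2 = mk⇔ meet close
  where
  ∣p∣+∣q∣≡4 : ∣ p ∣ + ∣ q ∣ ≡ 4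
  ∣p∣+∣q∣≡4 = cong₂ _+_ ∣p∣≡2 ∣q∣≡2
  meet : dist p q ≤ 3 → Nonempty (p ∩ q)
  meet d≤3 with nonempty? (p ∩ q)
  ... | yes p∩q≢∅ = p∩q≢∅
  ... | no  p∩q≡∅ =
    contradiction (subst (_≤ 3) (trans (Empty-∩⇒dist≡ p q p∩q≡∅) ∣p∣+∣q∣≡4) d≤3) (ℕ.<-irrefl refl)
  close : Nonempty (p ∩ q) → dist p q ≤ 3
  close p∩q≢∅ = ℕ.m≤n⇒m≤1+n (ℕ.+-cancelʳ-≤ 2 (dist p q) 2
    (subst (dist p q + 2 ≤_) ∣p∣+∣q∣≡4 (Nonempty-∩⇒dist+2≤ p q p∩q≢∅)))

∃-other-element : x ∈ p → 2 ≤ ∣ p ∣ → ∃[ y ] (y ≢ x × y ∈ p)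
∃-other-element {p = inside ∷ p} here (s≤s 1≤∣p∣) with 1≤∣p∣⇒Nonempty 1≤∣p∣
... | y , y∈p = suc y , (λ ()) , there y∈p
∃-other-element {p = inside  ∷ p} (there _) _ = zero , (λ ()) , here
∃-other-element {p = outside ∷ p} (there x∈p) 2≤∣p∣ with ∃-other-element x∈p 2≤∣p∣
... | y , y≢x , y∈p = suc y , (λ sy≡sx → y≢x (suc-injective sy≡sx)) , there y∈p

2-set-elements : ∣ p ∣ ≡ 2 → ∃[ x ] ∃[ y ] (x ≢ y × x ∈ p × y ∈ p)
2-set-elements ∣p∣≡2 with 1≤∣p∣⇒Nonempty (subst (1 ≤_) (sym ∣p∣≡2) (s≤s z≤n))
... | x , x∈p with ∃-other-element x∈p (ℕ.≤-reflexive (sym ∣p∣≡2))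
... | y , y≢x , y∈p = x , y , (λ x≡y → y≢x (sym x≡y)) , x∈p , y∈p

∈-2-set : ∣ p ∣ ≡ 2 → x ∈ p → y ∈ p → x ≢ y → z ∈ p → z ≡ x ⊎ z ≡ y
∈-2-set {p = p} {x} {y} {z} ∣p∣≡2 x∈p y∈p x≢y z∈p with z ≟ x | z ≟ y
... | yes z≡x | _       = inj₁ z≡x
... | no _    | yes z≡y = inj₂ z≡y
... | no z≢x  | no z≢y  = contradiction (subst (3 ≤_) ∣p∣≡2 3≤∣p∣) (ℕ.<-irrefl refl)
  where
  y∈p-x : y ∈ p - x
  y∈p-x = x∈p∧x≢y⇒x∈p-y y∈p (λ y≡x → x≢y (sym y≡x))
  z∈p-x-y : z ∈ p - x - y
  z∈p-x-y = x∈p∧x≢y⇒x∈p-y (x∈p∧x≢y⇒x∈p-y z∈p z≢x) z≢y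
  3≤∣p∣ : 3 ≤ ∣ p ∣
  3≤∣p∣ = ℕ.≤-trans (s≤s (ℕ.≤-trans (s≤s (Nonempty⇒1≤∣p∣ (z , z∈p-x-y))) (x∈p⇒∣p-x∣<∣p∣ y∈p-x)))
                     (x∈p⇒∣p-x∣<∣p∣ x∈p)

∈-⁅x⁆∪⁅y⁆ : z ∈ ⁅ x ⁆ ∪ ⁅ y ⁆ → z ≡ x ⊎ z ≡ y
∈-⁅x⁆∪⁅y⁆ {x = x} {y} z∈ = Sum.map (x∈⁅y⁆⇒x≡y x) (x∈⁅y⁆⇒x≡y y) (x∈p∪q⁻ ⁅ x ⁆ ⁅ y ⁆ z∈)

2-set≡⁅x⁆∪⁅y⁆ : ∣ p ∣ ≡ 2 → x ∈ p → y ∈ p → x ≢ y → p ≡ ⁅ x ⁆ ∪ ⁅ y ⁆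
2-set≡⁅x⁆∪⁅y⁆ {p = p} {x} {y} ∣p∣≡2 x∈p y∈p x≢y = ⊆-antisym p⊆ ⊆p
  where
  p⊆ : p ⊆ ⁅ x ⁆ ∪ ⁅ y ⁆
  p⊆ z∈p with ∈-2-set ∣p∣≡2 x∈p y∈p x≢y z∈p
  ... | inj₁ refl = x∈p∪q⁺ (inj₁ (x∈⁅x⁆ x))
  ... | inj₂ refl = x∈p∪q⁺ (inj₂ (x∈⁅x⁆ y))
  ⊆p : ⁅ x ⁆ ∪ ⁅ y ⁆ ⊆ p
  ⊆p z∈ with ∈-⁅x⁆∪⁅y⁆ z∈
  ... | inj₁ refl = x∈p
  ... | inj₂ refl = y∈p

∣⁅x⁆∪⁅y⁆∣≡2 : x ≢ y → ∣ ⁅ x ⁆ ∪ ⁅ y ⁆ ∣ ≡ 2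
∣⁅x⁆∪⁅y⁆∣≡2 {x = zero}  {zero}  x≢y = contradiction refl x≢y
∣⁅x⁆∪⁅y⁆∣≡2 {x = zero}  {suc y} _   = cong suc (trans (cong ∣_∣ (∪-identityˡ ⁅ y ⁆)) (∣⁅x⁆∣≡1 y))
∣⁅x⁆∪⁅y⁆∣≡2 {x = suc x} {zero}  _   = cong suc (trans (cong ∣_∣ (∪-identityʳ ⁅ x ⁆)) (∣⁅x⁆∣≡1 x))
∣⁅x⁆∪⁅y⁆∣≡2 {x = suc x} {suc y} x≢y = ∣⁅x⁆∪⁅y⁆∣≡2 (λ x≡y → x≢y (cong suc x≡y))

2-set-meets-off : ∣ p ∣ ≡ 2 → x ∈ p → y ∈ p → x ≢ y → Nonempty (p ∩ q) → x ∉ q → y ∈ q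
2-set-meets-off {p = p} {q = q} ∣p∣≡2 x∈p y∈p x≢y (z , z∈p∩q) x∉q
  with x∈p∩q⁻ p q z∈p∩q
... | z∈p , z∈q with ∈-2-set ∣p∣≡2 x∈p y∈p x≢y z∈p
...   | inj₁ refl = contradiction z∈q x∉q
...   | inj₂ refl = z∈q

meets-⁅x⁆∪⁅y⁆ : Nonempty (p ∩ (⁅ x ⁆ ∪ ⁅ y ⁆)) → x ∈ p ⊎ y ∈ p
meets-⁅x⁆∪⁅y⁆ {p = p} (z , z∈) with x∈p∩q⁻ p _ z∈
... | z∈p , z∈⁅x⁆∪⁅y⁆ with ∈-⁅x⁆∪⁅y⁆ z∈⁅x⁆∪⁅y⁆
...   | inj₁ refl = inj₁ z∈p
...   | inj₂ refl = inj₂ z∈p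

TriangleEdge : Fin n → Fin n → Fin n → Subset n → Set
TriangleEdge x y z p = p ≡ ⁅ x ⁆ ∪ ⁅ y ⁆ ⊎ p ≡ ⁅ x ⁆ ∪ ⁅ z ⁆ ⊎ p ≡ ⁅ y ⁆ ∪ ⁅ z ⁆

singleton∈N[∅] : ∣ p ∣ ≡ 1 → N[ ∅ ] p
singleton∈N[∅] {p = p} ∣p∣≡1 = inj₂ (trans (dist-∅ p) ∣p∣≡1)

2-set∉N[∅] : ∣ p ∣ ≡ 2 → ¬ N[ ∅ ] p
2-set∉N[∅] {n} ∣p∣≡2 (inj₁ refl) = contradiction (trans (sym ∣p∣≡2) (∣⊥∣≡0 n)) λ ()
2-set∉N[∅] {p = p} ∣p∣≡2 (inj₂ d≡1) =
  contradiction (trans (sym ∣p∣≡2) (trans (sym (dist-∅ p)) d≡1)) λ ()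

2-set-∈⇔FormI : ∣ p ∣ ≡ 2 → x ∈ p ⇔ FormI x p
2-set-∈⇔FormI {p = p} {x} ∣p∣≡2 = mk⇔ formI ∈p
  where
  formI : x ∈ p → FormI x p
  formI x∈p = inj₂ (inj₂ (ℕ.suc-injective (trans (x∈p⇒1+dist⁅x⁆p≡∣p∣ x∈p) ∣p∣≡2)))
  ∈p : FormI x p → x ∈ p
  ∈p (inj₁ p∈N[∅]) = contradiction p∈N[∅] (2-set∉N[∅] ∣p∣≡2)
  ∈p (inj₂ (inj₁ refl)) = contradiction (trans (sym ∣p∣≡2) (∣⁅x⁆∣≡1 x)) λ ()
  ∈p (inj₂ (inj₂ d≡1)) with x ∈? p
  ... | yes x∈p = x∈p
  ... | no  x∉p =
    contradiction (trans (sym d≡1) (trans (x∉p⇒dist⁅x⁆p≡1+∣p∣ x∉p) (cong suc ∣p∣≡2))) λ ()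

2-set-TriangleEdge⇔FormII : ∣ p ∣ ≡ 2 → TriangleEdge x y z p ⇔ FormII x y z p
2-set-TriangleEdge⇔FormII {p = p} ∣p∣≡2 = mk⇔ formII edge
  where
  formII : TriangleEdge _ _ _ p → FormII _ _ _ p
  formII (inj₁ refl)        = inj₂ (inj₂ (inj₁ (sym (Δ-identityˡ _))))
  formII (inj₂ (inj₁ refl)) = inj₂ (inj₂ (inj₂ (inj₁ (sym (Δ-identityˡ _)))))
  formII (inj₂ (inj₂ refl)) = inj₂ (inj₂ (inj₂ (inj₂ (sym (Δ-identityˡ _)))))
  edge : FormII _ _ _ p → TriangleEdge _ _ _ p
  edge (inj₁ p∈N[∅])                     = contradiction p∈N[∅] (2-set∉N[∅] ∣p∣≡2)
  edge (inj₂ (inj₁ p≡∅))                 = contradiction (inj₁ p≡∅) (2-set∉N[∅] ∣p∣≡2)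
  edge (inj₂ (inj₂ (inj₁ refl)))         = inj₁ (Δ-identityˡ _)
  edge (inj₂ (inj₂ (inj₂ (inj₁ refl))))  = inj₂ (inj₁ (Δ-identityˡ _))
  edge (inj₂ (inj₂ (inj₂ (inj₂ refl))))  = inj₂ (inj₂ (Δ-identityˡ _))

meets-triangle⇒TriangleEdge : x ≢ y → x ≢ z → y ≢ z → ∣ p ∣ ≡ 2 →
  Nonempty (p ∩ (⁅ x ⁆ ∪ ⁅ y ⁆)) → Nonempty (p ∩ (⁅ x ⁆ ∪ ⁅ z ⁆)) → Nonempty (p ∩ (⁅ y ⁆ ∪ ⁅ z ⁆)) →
  TriangleEdge x y z p
meets-triangle⇒TriangleEdge {x = x} {y} {z} {p} x≢y x≢z y≢z ∣p∣≡2 p∩xy p∩xz p∩yz =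
  edge (meets-⁅x⁆∪⁅y⁆ p∩xy) (meets-⁅x⁆∪⁅y⁆ p∩xz) (meets-⁅x⁆∪⁅y⁆ p∩yz)
  where
  edge : x ∈ p ⊎ y ∈ p → x ∈ p ⊎ z ∈ p → y ∈ p ⊎ z ∈ p → TriangleEdge x y z p
  edge (inj₁ x∈p) (inj₁ _)   (inj₁ y∈p) = inj₁ (2-set≡⁅x⁆∪⁅y⁆ ∣p∣≡2 x∈p y∈p x≢y)
  edge (inj₁ x∈p) (inj₁ _)   (inj₂ z∈p) = inj₂ (inj₁ (2-set≡⁅x⁆∪⁅y⁆ ∣p∣≡2 x∈p z∈p x≢z))
  edge (inj₁ x∈p) (inj₂ z∈p) _          = inj₂ (inj₁ (2-set≡⁅x⁆∪⁅y⁆ ∣p∣≡2 x∈p z∈p x≢z))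
  edge (inj₂ y∈p) (inj₁ x∈p) _          = inj₁ (2-set≡⁅x⁆∪⁅y⁆ ∣p∣≡2 x∈p y∈p x≢y)
  edge (inj₂ y∈p) (inj₂ z∈p) _          = inj₂ (inj₂ (2-set≡⁅x⁆∪⁅y⁆ ∣p∣≡2 y∈p z∈p y≢z))

IsStar : Fin n → List (Subset n) → Set
IsStar x 𝓕 = ∀ {p} → p ∈L 𝓕 → ∣ p ∣ ≡ 2 → x ∈ p

IsIntersecting : List (Subset n) → Set
IsIntersecting 𝓕 = ∀ {p q} → p ∈L 𝓕 → q ∈L 𝓕 → ∣ p ∣ ≡ 2 → ∣ q ∣ ≡ 2 → Nonempty (p ∩ q)

record Triangle (𝓕 : List (Subset n)) : Set where
  field
    i₁ i₂ i₃ : Fin n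
    i₁≢i₂    : i₁ ≢ i₂
    i₁≢i₃    : i₁ ≢ i₃
    i₂≢i₃    : i₂ ≢ i₃
    i₁i₂∈𝓕   : ⁅ i₁ ⁆ ∪ ⁅ i₂ ⁆ ∈L 𝓕
    i₁i₃∈𝓕   : ⁅ i₁ ⁆ ∪ ⁅ i₃ ⁆ ∈L 𝓕
    i₂i₃∈𝓕   : ⁅ i₂ ⁆ ∪ ⁅ i₃ ⁆ ∈L 𝓕

IsStar⊎avoiding-2-set : (x : Fin n) (𝓕 : List (Subset n)) →
                        IsStar x 𝓕 ⊎ ∃[ p ] (p ∈L 𝓕 × ∣ p ∣ ≡ 2 × x ∉ p)
IsStar⊎avoiding-2-set x [] = inj₁ λ ()
IsStar⊎avoiding-2-set x (p ∷ 𝓕) with ∣ p ∣ ℕ.≟ 2 | x ∈? p | IsStar⊎avoiding-2-set x 𝓕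
... | yes ∣p∣≡2 | no x∉p | _                      = inj₂ (p , hereL refl , ∣p∣≡2 , x∉p)
... | _         | _      | inj₂ (q , q∈𝓕 , avoids) = inj₂ (q , thereL q∈𝓕 , avoids)
... | no ∣p∣≢2  | _      | inj₁ star =
  inj₁ λ { (hereL refl) ∣p∣≡2 → contradiction ∣p∣≡2 ∣p∣≢2 ; (thereL q∈𝓕) → star q∈𝓕 }
... | yes _     | yes x∈p | inj₁ star =
  inj₁ λ { (hereL refl) _ → x∈p ; (thereL q∈𝓕) → star q∈𝓕 }

-- The point x₀ only matters when 𝓕 contains no 2-set at all.
star⊎triangle : {𝓕 : List (Subset n)} → Fin n → IsIntersecting 𝓕 → (∃[ x ] IsStar x 𝓕) ⊎ Triangle 𝓕
star⊎triangle {𝓕 = 𝓕} x₀ intersecting with IsStar⊎avoiding-2-set x₀ 𝓕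
... | inj₁ star = inj₁ (x₀ , star)
... | inj₂ (q , q∈𝓕 , ∣q∣≡2 , _) with 2-set-elements ∣q∣≡2
... | b , c , b≢c , b∈q , c∈q with IsStar⊎avoiding-2-set b 𝓕 | IsStar⊎avoiding-2-set c 𝓕
... | inj₁ star | _         = inj₁ (b , star)
... | inj₂ _    | inj₁ star = inj₁ (c , star)
... | inj₂ (r , r∈𝓕 , ∣r∣≡2 , b∉r) | inj₂ (s , s∈𝓕 , ∣s∣≡2 , c∉s) =
  inj₂ (triangle (∃-other-element c∈r (ℕ.≤-reflexive (sym ∣r∣≡2))))
  where
  c∈r : c ∈ r
  c∈r = 2-set-meets-off ∣q∣≡2 b∈q c∈q b≢c (intersecting q∈𝓕 r∈𝓕 ∣q∣≡2 ∣r∣≡2) b∉r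
  b∈s : b ∈ s
  b∈s = 2-set-meets-off ∣q∣≡2 c∈q b∈q (λ c≡b → b≢c (sym c≡b)) (intersecting q∈𝓕 s∈𝓕 ∣q∣≡2 ∣s∣≡2) c∉s
  triangle : ∃[ d ] (d ≢ c × d ∈ r) → Triangle 𝓕
  triangle (d , d≢c , d∈r) = record
    { i₁ = b ; i₂ = c ; i₃ = d
    ; i₁≢i₂ = b≢c ; i₁≢i₃ = b≢d ; i₂≢i₃ = c≢d
    ; i₁i₂∈𝓕 = subst (_∈L 𝓕) (2-set≡⁅x⁆∪⁅y⁆ ∣q∣≡2 b∈q c∈q b≢c) q∈𝓕
    ; i₁i₃∈𝓕 = subst (_∈L 𝓕) (2-set≡⁅x⁆∪⁅y⁆ ∣s∣≡2 b∈s d∈s b≢d) s∈𝓕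
    ; i₂i₃∈𝓕 = subst (_∈L 𝓕) (2-set≡⁅x⁆∪⁅y⁆ ∣r∣≡2 c∈r d∈r c≢d) r∈𝓕
    }
    where
    c≢d : c ≢ d
    c≢d c≡d = d≢c (sym c≡d)
    b≢d : b ≢ d
    b≢d refl = b∉r d∈r
    d∈s : d ∈ s
    d∈s = 2-set-meets-off ∣r∣≡2 c∈r d∈r c≢d (intersecting r∈𝓕 s∈𝓕 ∣r∣≡2 ∣s∣≡2) c∉s

Vertex⇒Nonempty : Vertex p → Nonempty p
Vertex⇒Nonempty (inj₁ ∣p∣≡1) = 1≤∣p∣⇒Nonempty (ℕ.≤-reflexive (sym ∣p∣≡1))
Vertex⇒Nonempty (inj₂ ∣p∣≡2) = 1≤∣p∣⇒Nonempty (subst (1 ≤_) (sym ∣p∣≡2) (s≤s z≤n))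

IsFace⇒Fin : {σ : List (Subset n)} → IsFace σ → Fin n
IsFace⇒Fin (vertices , (p , p∈σ) , _) = proj₁ (Vertex⇒Nonempty {p = p} (vertices p∈σ))

module _ {σ : List (Subset n)} (maximal : IsMaximalFace σ) where

  private
    vertex : p ∈L σ → Vertex p
    vertex = proj₁ (proj₁ maximal)

    close : p ∈L σ → q ∈L σ → dist p q ≤ 3
    close = proj₂ (proj₂ (proj₁ maximal))

  ∈-maximal : Vertex p → (∀ {q} → q ∈L σ → dist p q ≤ 3) → p ∈L σ
  ∈-maximal {p} p-vertex p-close =
    proj₂ maximal (p ∷ σ) (vertices , (p , hereL refl) , distances) thereL (hereL refl)
    where
    vertices : q ∈L p ∷ σ → Vertex q
    vertices (hereL refl)  = p-vertex
    vertices (thereL q∈σ) = vertex q∈σ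
    distances : q ∈L p ∷ σ → r ∈L p ∷ σ → dist q r ≤ 3
    distances (hereL refl)  (hereL refl)  = subst (_≤ 3) (sym (dist-self p)) z≤n
    distances (hereL refl)  (thereL r∈σ) = p-close r∈σ
    distances (thereL q∈σ) (hereL refl)  = subst (_≤ 3) (dist-comm p _) (p-close q∈σ)
    distances (thereL q∈σ) (thereL r∈σ) = close q∈σ r∈σ

  singleton∈maximal : ∣ p ∣ ≡ 1 → p ∈L σ
  singleton∈maximal {p} ∣p∣≡1 =
    ∈-maximal (inj₁ ∣p∣≡1) (λ {q} q∈σ → singleton-dist≤3 {p = p} {q} ∣p∣≡1 (vertex q∈σ))

  maximal-intersecting : IsIntersecting σ
  maximal-intersecting p∈σ q∈σ ∣p∣≡2 ∣q∣≡2 = to (2-sets-dist≤3⇔meet ∣p∣≡2 ∣q∣≡2) (close p∈σ q∈σ)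

  maximal-EqVertexMeet : (X : Subset n → Set) → (∀ {p} → ∣ p ∣ ≡ 1 → X p) →
                         (∀ {p} → ∣ p ∣ ≡ 2 → p ∈L σ ⇔ X p) → EqVertexMeet σ X
  maximal-EqVertexMeet X singletons 2-sets p = sound , complete
    where
    sound : p ∈L σ → Vertex p × X p
    sound p∈σ with vertex p∈σ
    ... | inj₁ ∣p∣≡1 = inj₁ ∣p∣≡1 , singletons ∣p∣≡1
    ... | inj₂ ∣p∣≡2 = inj₂ ∣p∣≡2 , to (2-sets ∣p∣≡2) p∈σ
    complete : Vertex p × X p → p ∈L σ
    complete (inj₁ ∣p∣≡1 , _)  = singleton∈maximal ∣p∣≡1
    complete (inj₂ ∣p∣≡2 , Xp) = from (2-sets ∣p∣≡2) Xp

  star⇒FormI : IsStar x σ → EqVertexMeet σ (FormI x)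
  star⇒FormI {x} star =
    maximal-EqVertexMeet (FormI x) (λ ∣p∣≡1 → inj₁ (singleton∈N[∅] ∣p∣≡1))
      (λ ∣p∣≡2 → 2-set-∈⇔FormI ∣p∣≡2 ⇔-∘ mk⇔ (λ p∈σ → star p∈σ ∣p∣≡2) (∈σ ∣p∣≡2))
    where
    ∈σ : ∣ p ∣ ≡ 2 → x ∈ p → p ∈L σ
    ∈σ {p} ∣p∣≡2 x∈p = ∈-maximal (inj₂ ∣p∣≡2) near
      where
      near : q ∈L σ → dist p q ≤ 3
      near {q} q∈σ with vertex q∈σ
      ... | inj₁ ∣q∣≡1 = subst (_≤ 3) (dist-comm q p) (singleton-dist≤3 {p = q} {p} ∣q∣≡1 (inj₂ ∣p∣≡2))
      ... | inj₂ ∣q∣≡2 = from (2-sets-dist≤3⇔meet ∣p∣≡2 ∣q∣≡2) (x , x∈p∩q⁺ (x∈p , star q∈σ ∣q∣≡2))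

  triangle⇒FormII : (t : Triangle σ) → let open Triangle t in EqVertexMeet σ (FormII i₁ i₂ i₃)
  triangle⇒FormII t =
    maximal-EqVertexMeet (FormII i₁ i₂ i₃) (λ ∣p∣≡1 → inj₁ (singleton∈N[∅] ∣p∣≡1))
      (λ ∣p∣≡2 → 2-set-TriangleEdge⇔FormII ∣p∣≡2 ⇔-∘ mk⇔ (edge ∣p∣≡2) ∈σ)
    where
    open Triangle t
    meets : p ∈L σ → ∣ p ∣ ≡ 2 → ∀ {x y} → x ≢ y → ⁅ x ⁆ ∪ ⁅ y ⁆ ∈L σ → Nonempty (p ∩ (⁅ x ⁆ ∪ ⁅ y ⁆))
    meets p∈σ ∣p∣≡2 x≢y xy∈σ = maximal-intersecting p∈σ xy∈σ ∣p∣≡2 (∣⁅x⁆∪⁅y⁆∣≡2 x≢y)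
    edge : ∣ p ∣ ≡ 2 → p ∈L σ → TriangleEdge i₁ i₂ i₃ p
    edge ∣p∣≡2 p∈σ = meets-triangle⇒TriangleEdge i₁≢i₂ i₁≢i₃ i₂≢i₃ ∣p∣≡2
      (meets p∈σ ∣p∣≡2 i₁≢i₂ i₁i₂∈𝓕) (meets p∈σ ∣p∣≡2 i₁≢i₃ i₁i₃∈𝓕) (meets p∈σ ∣p∣≡2 i₂≢i₃ i₂i₃∈𝓕)
    ∈σ : TriangleEdge i₁ i₂ i₃ p → p ∈L σ
    ∈σ (inj₁ refl)        = i₁i₂∈𝓕
    ∈σ (inj₂ (inj₁ refl)) = i₁i₃∈𝓕
    ∈σ (inj₂ (inj₂ refl)) = i₂i₃∈𝓕

corollary3p3 : (n : ℕ) (σ : List (Subset n)) → IsMaximalFace σ →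
    ∃[ i₁ ] ∃[ i₂ ] ∃[ i₃ ] (EqVertexMeet σ (FormI i₁) ⊎ EqVertexMeet σ (FormII i₁ i₂ i₃))
corollary3p3 n σ maximal with star⊎triangle (IsFace⇒Fin (proj₁ maximal)) (maximal-intersecting maximal)
... | inj₁ (x , star) = x , x , x , inj₁ (star⇒FormI maximal star)
... | inj₂ t          = i₁ , i₂ , i₃ , inj₂ (triangle⇒FormII maximal t)
  where open Triangle t
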